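{- For every integer $r\geq 3$ and every $n\geq r$, we have $\mathrm{tc}_{r,r-2}(K_n)\geq 2$.
   Context: For integers $r\geq k\geq 1$, an $(r,k)$-colouring of a graph $G$ is a function $\varphi:E(G)\to\binom{[r]}{k}$, assigning to each edge a set of exactly $k$ colours from $[r]=\{1,\dots,r\}$. A subgraph $H\subseteq G$ is monochromatic if there is a colour $i$ belonging to $\varphi(e)$ for every $e\in E(H)$. $\mathrm{tc}(G,\varphi)$ is the minimum number of monochromatic trees (a single vertex counts as a tree) whose union covers $V(G)$, and $\mathrm{tc}_{r,k}(G)$ is the minimum $m$ such that every $(r,k)$-colouring $\varphi$ of $G$ satisfies $\mathrm{tc}(G,\varphi)\leq m$. -}

module Defs where

open import Data.Nat using (ℕ; _≤_)
open import Data.Fin using (Fin)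
open import Data.Fin.Subset using (Subset; ∣_∣) renaming (_∈_ to _∈ₛ_)
open import Data.List using (List; []; _∷_; length)
open import Data.List.Membership.Propositional using (_∈_; _∉_)
open import Data.List.Relation.Unary.Any using (Any)
open import Data.Product using (Σ; _×_)
open import Relation.Binary.PropositionalEquality using (_≡_; _≢_)

-- Edges of K_n are unordered pairs {u,v} with u ≢ v; we represent the
-- colouring as a symmetric function on ordered pairs (its values on the
-- diagonal u = v are irrelevant, since those are not edges).
record Colouring (r k n : ℕ) : Set where
  field
    col  : Fin n → Fin n → Subset r
    sym  : ∀ u v → col u v ≡ col v u
    card : ∀ u v → u ≢ v → ∣ col u v ∣ ≡ k
open Colouring public

-- Trees are built by the standard inductive definition: a single vertex
-- is a tree, and attaching a new vertex u to a vertex v of a tree by an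
-- edge uv gives a tree.
data MonoTree {r k n : ℕ} (φ : Colouring r k n) (i : Fin r) : List (Fin n) → Set where
  single : (v : Fin n) → MonoTree φ i (v ∷ [])
  grow   : {vs : List (Fin n)} (u v : Fin n) → MonoTree φ i vs →
           v ∈ vs → u ∉ vs → i ∈ₛ col φ u v → MonoTree φ i (u ∷ vs)

record SomeMonoTree {r k n : ℕ} (φ : Colouring r k n) : Set where
  field
    verts  : List (Fin n)
    colour : Fin r
    tree   : MonoTree φ colour verts
open SomeMonoTree public

TcAtMost : {r k n : ℕ} → Colouring r k n → ℕ → Set
TcAtMost {n = n} φ m =
  Σ (List (SomeMonoTree φ)) λ ts →
    (length ts ≤ m) × ((v : Fin n) → Any (λ t → v ∈ verts t) ts)

module Submission where

-- Tag every vertex with a colour so that each colour tags some vertex, and give the edge uv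
-- all colours except the tags of u and v (padded to two excluded colours when the tags
-- agree).  A vertex tagged i then meets no edge of colour i, so no tree of colour i can
-- contain it together with any other vertex; hence no single monochromatic tree spans K_n.

open import Defs
open import Data.Nat using (ℕ; suc; _≤_; _∸_; _%_; s≤s)
open import Data.Nat.DivMod using (_mod_; m<n⇒m%n≡m)
open import Data.Fin using (Fin; zero; suc; toℕ; inject≤; punchIn; _≟_)
open import Data.Fin.Properties using (toℕ-injective; toℕ-fromℕ<; toℕ-inject≤; toℕ<n; punchInᵢ≢i)
open import Data.Fin.Subset using (Subset; ∣_∣; ⁅_⁆; _∪_; ∁) renaming (_∈_ to _∈ₛ_; _∉_ to _∉ₛ_)
open import Data.Fin.Subset.Properties
  using (∣⁅x⁆∣≡1; ∣∁p∣≡n∸∣p∣; ∪-comm; ∪-identityˡ; ∪-identityʳ; x∈⁅x⁆; p⊆p∪q; x∈p⇒x∉∁p)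
open import Data.List using ([]; _∷_)
open import Data.List.Relation.Unary.Any using (here; there)
open import Data.List.Membership.Propositional using (_∈_)
open import Data.Product using (Σ; ∃; _,_)
open import Data.Empty using (⊥-elim)
open import Relation.Nullary using (¬_; yes; no)
open import Relation.Binary.PropositionalEquality
  using (_≡_; _≢_; refl; cong; subst; trans; module ≡-Reasoning) renaming (sym to ≡-sym)

Avoids : ∀ {r k n} → Colouring r k n → Fin r → Fin n → Set
Avoids φ i x = ∀ w → i ∉ₛ col φ x w

MonoTree-incident : ∀ {r k n} {φ : Colouring r k n} {i vs} → MonoTree φ i vs →
                    ∀ {x y} → x ∈ vs → y ∈ vs → x ≢ y → ∃ λ w → i ∈ₛ col φ x w
MonoTree-incident (single _) (here refl) (here refl) x≢y = ⊥-elim (x≢y refl)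
MonoTree-incident (grow _ v _ _ _ i∈uv) (here refl) _ _ = v , i∈uv
MonoTree-incident {φ = φ} {i} (grow u v T v∈vs _ i∈uv) {x} (there x∈vs) (here refl) x≢u
  with x ≟ v
... | yes refl = u , subst (i ∈ₛ_) (Colouring.sym φ u x) i∈uv
... | no x≢v   = MonoTree-incident T x∈vs v∈vs x≢v
MonoTree-incident (grow u v T _ _ _) (there x∈vs) (there y∈vs) x≢y =
  MonoTree-incident T x∈vs y∈vs x≢y

¬TcAtMost-1 : ∀ {r k n} (φ : Colouring r k n) → Fin n → (∀ x → ∃ (x ≢_)) →
              (∀ i → ∃ (Avoids φ i)) → ¬ TcAtMost φ 1
¬TcAtMost-1 φ x₀ _ _ ([] , _ , cover) with cover x₀
... | ()
¬TcAtMost-1 φ _ _ _ (_ ∷ _ ∷ _ , s≤s () , _)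
¬TcAtMost-1 φ _ distinct avoided (t ∷ [] , _ , cover)
  with avoided (colour t)
... | x , x-avoids with distinct x
... | y , x≢y with cover x | cover y
... | here x∈t | here y∈t =
  let w , i∈xw = MonoTree-incident (tree t) x∈t y∈t x≢y in x-avoids w i∈xw

∣⁅x⁆∪⁅y⁆∣≡2 : ∀ {n} {x y : Fin n} → x ≢ y → ∣ ⁅ x ⁆ ∪ ⁅ y ⁆ ∣ ≡ 2
∣⁅x⁆∪⁅y⁆∣≡2 {x = zero}  {zero}  x≢y = ⊥-elim (x≢y refl)
∣⁅x⁆∪⁅y⁆∣≡2 {x = zero}  {suc y} _   = cong suc (trans (cong ∣_∣ (∪-identityˡ ⁅ y ⁆)) (∣⁅x⁆∣≡1 y))
∣⁅x⁆∪⁅y⁆∣≡2 {x = suc x} {zero}  _   = cong suc (trans (cong ∣_∣ (∪-identityʳ ⁅ x ⁆)) (∣⁅x⁆∣≡1 x))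
∣⁅x⁆∪⁅y⁆∣≡2 {x = suc x} {suc y} x≢y = ∣⁅x⁆∪⁅y⁆∣≡2 (λ x≡y → x≢y (cong suc x≡y))

module _ {k : ℕ} where

  private
    C : Set
    C = Fin (suc (suc k))

  -- When a = b a second excluded colour is needed so that exactly k colours remain.
  excluded : C → C → Subset (suc (suc k))
  excluded a b with a ≟ b
  ... | yes _ = ⁅ a ⁆ ∪ ⁅ punchIn a zero ⁆
  ... | no  _ = ⁅ a ⁆ ∪ ⁅ b ⁆

  excluded-comm : ∀ a b → excluded a b ≡ excluded b a
  excluded-comm a b with a ≟ b | b ≟ a
  ... | yes refl | yes _   = refl
  ... | yes a≡b  | no b≢a  = ⊥-elim (b≢a (≡-sym a≡b))
  ... | no a≢b   | yes b≡a = ⊥-elim (a≢b (≡-sym b≡a))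
  ... | no _     | no _    = ∪-comm ⁅ a ⁆ ⁅ b ⁆

  ∣excluded∣≡2 : ∀ a b → ∣ excluded a b ∣ ≡ 2
  ∣excluded∣≡2 a b with a ≟ b
  ... | yes _   = ∣⁅x⁆∪⁅y⁆∣≡2 (λ a≡a′ → punchInᵢ≢i a zero (≡-sym a≡a′))
  ... | no a≢b  = ∣⁅x⁆∪⁅y⁆∣≡2 a≢b

  a∈excluded : ∀ a b → a ∈ₛ excluded a b
  a∈excluded a b with a ≟ b
  ... | yes _ = p⊆p∪q ⁅ punchIn a zero ⁆ (x∈⁅x⁆ a)
  ... | no  _ = p⊆p∪q ⁅ b ⁆ (x∈⁅x⁆ a)

  colouringByTag : ∀ {n} → (Fin n → C) → Colouring (suc (suc k)) k n
  col  (colouringByTag tag) u v   = ∁ (excluded (tag u) (tag v))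
  Colouring.sym (colouringByTag tag) u v = cong ∁ (excluded-comm (tag u) (tag v))
  card (colouringByTag tag) u v _ =
    trans (∣∁p∣≡n∸∣p∣ (excluded (tag u) (tag v)))
          (cong (suc (suc k) ∸_) (∣excluded∣≡2 (tag u) (tag v)))

  colouringByTag-avoids : ∀ {n} (tag : Fin n → C) x → Avoids (colouringByTag tag) (tag x) x
  colouringByTag-avoids tag x w = x∈p⇒x∉∁p (a∈excluded (tag x) (tag w))

inject≤-mod : ∀ {m n} (i : Fin (suc m)) (m<n : suc m ≤ n) → toℕ (inject≤ i m<n) mod suc m ≡ i
inject≤-mod {m} i m<n = toℕ-injective (begin
  toℕ (toℕ (inject≤ i m<n) mod suc m) ≡⟨ toℕ-fromℕ< _ ⟩
  toℕ (inject≤ i m<n) % suc m ≡⟨ cong (_% suc m) (toℕ-inject≤ i m<n) ⟩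
  toℕ i % suc m              ≡⟨ m<n⇒m%n≡m (toℕ<n i) ⟩
  toℕ i                               ∎)
  where open ≡-Reasoning

lemma2p7 : (r n : ℕ) → 3 ≤ r → r ≤ n →
    Σ (Colouring r (r ∸ 2) n) (λ φ → ¬ TcAtMost φ 1)
lemma2p7 (suc (suc k)) n (s≤s (s≤s _)) r≤n = φ , ¬TcAtMost-1 φ (vertex zero) distinct avoided
  where
  tag : Fin n → Fin (suc (suc k))
  tag u = toℕ u mod suc (suc k)

  vertex : Fin (suc (suc k)) → Fin n
  vertex i = inject≤ i r≤n

  φ : Colouring (suc (suc k)) k n
  φ = colouringByTag tag

  avoided : ∀ i → ∃ (Avoids φ i)
  avoided i = vertex i , subst (λ j → Avoids φ j (vertex i)) (inject≤-mod i r≤n)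
                                (colouringByTag-avoids tag (vertex i))

  distinct : ∀ x → ∃ (x ≢_)
  distinct x = vertex (punchIn (tag x) zero) , λ x≡y →
    punchInᵢ≢i (tag x) zero (≡-sym (trans (cong tag x≡y) (inject≤-mod _ r≤n)))
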